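{- Let $G$ be the $\ell\times m$ grid graph with $\ell\le m$. Then $\mathrm{Opt}(G)=\Theta(\ell)$; that is, there are absolute constants $c_1,c_2>0$ such that $c_1\ell\le\mathrm{Opt}(G)\le c_2\ell$ for all such grids.
   Context: For an undirected graph $G=(V,E)$ and $S\subseteq V$, $\mathcal{P}_S$ is obtained by (Rule 1) putting every node of $S$ and every neighbor of a node of $S$ into $\mathcal{P}_S$, and (Rule 2) repeatedly: if $v\in\mathcal{P}_S$ and all neighbors of $v$ except exactly one neighbor $w$ are in $\mathcal{P}_S$, insert $w$. $S$ power dominates $G$ if $\mathcal{P}_S=V$, and $\mathrm{Opt}(G)$ is the minimum size of a set power dominating $G$. -}

module Defs where

open import Data.Nat using (ℕ; suc; _≤_; _*_; NonZero)
open import Data.Fin using (Fin; toℕ)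
open import Data.Product using (_×_; _,_; Σ; ∃)
open import Data.Sum using (_⊎_)
open import Data.List using (List; length)
open import Data.List.Membership.Propositional using (_∈_)
open import Data.List.Relation.Unary.Unique.Propositional using (Unique)
open import Relation.Binary.PropositionalEquality using (_≡_; _≢_)

record Graph : Set₁ where
  field
    V   : Set
    Adj : V → V → Set
open Graph public

Succ± : ∀ {n} → Fin n → Fin n → Set
Succ± a b = (suc (toℕ a) ≡ toℕ b) ⊎ (suc (toℕ b) ≡ toℕ a)

Grid : ℕ → ℕ → Graph
Grid ℓ m = record
  { V   = Fin ℓ × Fin m
  ; Adj = λ { (i , j) (i' , j') → ((i ≡ i') × Succ± j j') ⊎ ((j ≡ j') × Succ± i i') } }

-- A vertex set S is represented by a duplicate-free list of vertices; |S| = length S.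
-- 𝒫 G S v : v belongs to the power-domination closure 𝒫_S (the least set closed
-- under Rule 1 and Rule 2).
data 𝒫 (G : Graph) (S : List (V G)) : V G → Set where
  rule1-self : ∀ {v} → v ∈ S → 𝒫 G S v
  rule1-nbr  : ∀ {u v} → u ∈ S → Adj G u v → 𝒫 G S v
  rule2      : ∀ {v w} → 𝒫 G S v → Adj G v w
             → (∀ x → Adj G v x → x ≢ w → 𝒫 G S x) → 𝒫 G S w

PowerDominates : (G : Graph) → List (V G) → Set
PowerDominates G S = ∀ v → 𝒫 G S v

OptAtMost : Graph → ℕ → Set
OptAtMost G k = Σ (List (V G)) λ S → Unique S × PowerDominates G S × length S ≤ k

-- "ℓ ≤ a · Opt(G)": every power dominating set S satisfies ℓ ≤ a · |S|.
ScaledOptAtLeast : Graph → ℕ → ℕ → Set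
ScaledOptAtLeast G a ℓ = ∀ (S : List (V G)) → Unique S → PowerDominates G S → ℓ ≤ a * length S

-- The upper bound: the first column dominates the second, and then each vertex of
-- column j forces its right neighbour, one column after another.
--
-- The lower bound follows the forcing process: colour the closed neighbourhood N[S]
-- (at most 5|S| vertices) and apply Rule 2 one vertex at a time.  Call a coloured
-- vertex active if it has an uncoloured neighbour.  When v forces w, v stops being
-- active and w may start, so the active vertices keep an injective labelling by
-- N[S], and there are never more than 5|S| of them.  Stop at the first step after
-- which some row or column is completely coloured.  If that is a row, every column
-- other than the one of the last forced vertex was not yet full, so it contains an
-- active vertex: m - 1 ≤ 5|S|.  Symmetrically ℓ - 1 ≤ 5|S| for a column, and with
-- ℓ ≤ m and |S| ≥ 1 this gives ℓ ≤ 6|S|.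
module Submission where

open import Defs
open import Data.Bool.Properties using (T-≡)
open import Data.Empty using (⊥-elim)
open import Data.Fin as Fin using (Fin; zero; suc; toℕ; inject₁; punchIn; combine)
open import Data.Fin.Properties as Fin
  using (all?; any?; ¬∀⟶∃¬; toℕ-injective; toℕ-inject₁; combine-injective; injective⇒≤;
         punchIn-injective; punchInᵢ≢i; *↔×)
open import Data.Fin.Subset using (Subset; _∈_; _∉_; _⊆_; _⊂_; _∪_; ⁅_⁆; ∣_∣)
open import Data.Fin.Subset.Properties
  using (_∈?_; ∣p∣≤n; p⊂q⇒∣p∣<∣q∣; p⊆p∪q; q⊆p∪q; x∈p∪q⁻; x∈⁅x⁆; x∈⁅y⁆⇒x≡y)
open import Data.List using (List; []; _∷_; length; map; allFin)
import Data.List as List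
open import Data.List.Membership.Propositional.Properties using (∈-map⁺; ∈-allFin)
open import Data.List.Properties using (length-map; length-tabulate)
open import Data.List.Relation.Unary.Any as Any using (Any)
open import Data.List.Relation.Unary.Any.Properties using (lookup-index)
open import Data.List.Relation.Unary.Unique.Propositional.Properties using (allFin⁺)
import Data.List.Relation.Unary.Unique.Propositional.Properties as Unique
import Data.List.Relation.Unary.AllPairs as AllPairs
open import Data.Nat as ℕ using (ℕ; zero; suc; _≤_; _+_; _*_; z≤n; s≤s; NonZero)
open import Data.Nat.Properties as ℕ
  using (≤-refl; ≤-trans; ≤-<-trans; <⇒≱; ≤-reflexive; n≤1+n; m≤m+n; +-suc; +-monoʳ-≤;
         +-mono-≤; *-identityˡ)
open import Data.Product using (_×_; _,_; Σ; ∃; ∃₂; proj₁; proj₂; uncurry)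
open import Data.Sum using (_⊎_; inj₁; inj₂; [_,_])
import Data.Sum as Sum
open import Data.Vec using (tabulate)
open import Data.Vec.Properties using (lookup∘tabulate; []=⇒lookup; lookup⇒[]=)
open import Function using (_∘_; id)
open import Function.Bundles using (_↔_; Inverse; Equivalence)
open import Function.Definitions using (Injective)
open import Function.Properties.Inverse using (↔-sym)
open import Relation.Binary.Definitions using (Decidable; DecidableEquality)
open import Relation.Binary.PropositionalEquality hiding ([_])
open import Relation.Nullary using (Dec; yes; no; ¬_; contradiction; ¬?)
open import Relation.Nullary.Decidable
  using (map′; _×-dec_; _⊎-dec_; _→-dec_; isYes; toWitness; fromWitness)

record Labelling {A : Set} (P : A → Set) (L : Set) : Set where
  field
    label           : ∀ {x} → P x → L
    label-injective : ∀ {x y} (p : P x) (q : P y) → label p ≡ label q → x ≡ y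
open Labelling

restrict : ∀ {A : Set} {P Q : A → Set} {L} → (∀ {x} → Q x → P x) → Labelling P L → Labelling Q L
restrict Q⇒P lab = record
  { label           = label lab ∘ Q⇒P
  ; label-injective = λ p q → label-injective lab (Q⇒P p) (Q⇒P q)
  }

mapLabels : ∀ {A : Set} {P : A → Set} {L L′ : Set} (f : L → L′) → Injective _≡_ _≡_ f →
            Labelling P L → Labelling P L′
mapLabels f f-inj lab = record
  { label           = f ∘ label lab
  ; label-injective = λ p q → label-injective lab p q ∘ f-inj
  }

labelled-family-≤ : ∀ {A : Set} {P : A → Set} {k r} → Labelling P (Fin k) →
                    (f : Fin r → A) → (∀ t → P (f t)) → Injective _≡_ _≡_ f → r ≤ k
labelled-family-≤ lab f Pf f-inj =
  injective⇒≤ λ {s} {t} eq → f-inj (label-injective lab (Pf s) (Pf t) eq)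

combine-pair-injective : ∀ {a b} → Injective _≡_ _≡_ (uncurry (combine {a} {b}))
combine-pair-injective {x = i , j} {y = k , l} eq
  with refl , refl ← combine-injective i j k l eq = refl

ClosedNbhd : (G : Graph) → V G → V G → Set
ClosedNbhd G u x = u ≡ x ⊎ Adj G u x

closedNbhd-labelling : ∀ {G k} → (∀ u → Labelling (Adj G u) (Fin k)) →
                       ∀ u → Labelling (ClosedNbhd G u) (Fin (suc k))
closedNbhd-labelling {G} {k} ports u = record { label = port ; label-injective = port-injective }
  where
  port : ∀ {x} → ClosedNbhd G u x → Fin (suc k)
  port (inj₁ _) = zero
  port (inj₂ a) = suc (label (ports u) a)

  port-injective : ∀ {x y} (p : ClosedNbhd G u x) (q : ClosedNbhd G u y) → port p ≡ port q → x ≡ y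
  port-injective (inj₁ refl) (inj₁ refl) _  = refl
  port-injective (inj₂ a)    (inj₂ b)    eq = label-injective (ports u) a b (Fin.suc-injective eq)
  port-injective (inj₁ _)    (inj₂ _)    ()
  port-injective (inj₂ _)    (inj₁ _)    ()

𝒫-nonempty : ∀ {G S x} → 𝒫 G S x → 1 ≤ length S
𝒫-nonempty {S = _ ∷ _} _                 = s≤s z≤n
𝒫-nonempty {S = []}    (rule1-self ())
𝒫-nonempty {S = []}    (rule1-nbr () _)
𝒫-nonempty {S = []}    (rule2 p _ _)     = 𝒫-nonempty p

-- Colourings are subsets of Fin n, transported along a numbering of the vertices,
-- so that the number of coloured vertices is the library's ∣_∣.
module Forcing (G : Graph) {n : ℕ} (enc : V G ↔ Fin n) (adj? : Decidable (Adj G))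
               (S : List (V G)) where

  open Inverse enc using (to; from; strictlyInverseʳ)

  to-injective : Injective _≡_ _≡_ to
  to-injective {x} {y} eq =
    trans (sym (strictlyInverseʳ x)) (trans (cong from eq) (strictlyInverseʳ y))

  _≟ᵛ_ : DecidableEquality (V G)
  x ≟ᵛ y = map′ to-injective (cong to) (to x Fin.≟ to y)

  ∀ᵛ? : {P : V G → Set} → (∀ x → Dec (P x)) → Dec (∀ x → P x)
  ∀ᵛ? {P} P? = map′ (λ h x → subst P (strictlyInverseʳ x) (h (to x))) (λ h → h ∘ from) (all? (P? ∘ from))

  ∃ᵛ? : {P : V G → Set} → (∀ x → Dec (P x)) → Dec (∃ P)
  ∃ᵛ? {P} P? = map′ (λ (k , p) → from k , p) (λ (x , p) → to x , subst P (sym (strictlyInverseʳ x)) p)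
                     (any? (P? ∘ from))

  Dominated : V G → Set
  Dominated x = Any (λ u → ClosedNbhd G u x) S

  dominated? : ∀ x → Dec (Dominated x)
  dominated? x = Any.any? (λ u → (u ≟ᵛ x) ⊎-dec adj? u x) S

  Colouring : Set
  Colouring = Subset n

  infix 4 _∈ᶜ_ _∉ᶜ_
  infixl 6 _⊕_

  _∈ᶜ_ _∉ᶜ_ : V G → Colouring → Set
  x ∈ᶜ C = to x ∈ C
  x ∉ᶜ C = to x ∉ C

  _∈ᶜ?_ : ∀ x C → Dec (x ∈ᶜ C)
  x ∈ᶜ? C = to x ∈? C

  initial : Colouring
  initial = tabulate (isYes ∘ dominated? ∘ from)

  initial-dominated : ∀ {x} → x ∈ᶜ initial → Dominated x
  initial-dominated {x} x∈ = subst Dominated (strictlyInverseʳ x)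
    (toWitness (Equivalence.from T-≡ (trans (sym (lookup∘tabulate _ (to x))) ([]=⇒lookup x∈))))

  dominated-initial : ∀ {x} → Dominated x → x ∈ᶜ initial
  dominated-initial {x} d = lookup⇒[]= (to x) initial
    (trans (lookup∘tabulate _ (to x))
           (Equivalence.to T-≡ (fromWitness (subst Dominated (sym (strictlyInverseʳ x)) d))))

  _⊕_ : Colouring → V G → Colouring
  C ⊕ w = C ∪ ⁅ to w ⁆

  ⊕-⊆ : ∀ {C w} → C ⊆ C ⊕ w
  ⊕-⊆ {w = w} = p⊆p∪q ⁅ to w ⁆

  ∈⊕-self : ∀ {C w} → w ∈ᶜ C ⊕ w
  ∈⊕-self {C} {w} = q⊆p∪q C ⁅ to w ⁆ (x∈⁅x⁆ (to w))

  ∈⊕⁻ : ∀ {C w x} → x ∈ᶜ C ⊕ w → x ∈ᶜ C ⊎ x ≡ w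
  ∈⊕⁻ {C} {w} x∈ = Sum.map₂ (to-injective ∘ x∈⁅y⁆⇒x≡y (to w)) (x∈p∪q⁻ C ⁅ to w ⁆ x∈)

  ∉⊕ : ∀ {C w x} → x ∉ᶜ C → x ≢ w → x ∉ᶜ C ⊕ w
  ∉⊕ x∉C x≢w = [ x∉C , x≢w ] ∘ ∈⊕⁻

  ⊕-⊂ : ∀ {C w} → w ∉ᶜ C → C ⊂ C ⊕ w
  ⊕-⊂ {w = w} w∉C = ⊕-⊆ , to w , ∈⊕-self , w∉C

  record Forces (C : Colouring) (v w : V G) : Set where
    constructor forcing
    field
      forcer-coloured   : v ∈ᶜ C
      target-uncoloured : w ∉ᶜ C
      adjacent          : Adj G v w
      others-coloured   : ∀ x → Adj G v x → x ≢ w → x ∈ᶜ C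
  open Forces

  forces? : ∀ C v w → Dec (Forces C v w)
  forces? C v w =
    map′ (λ (a , b , c , d) → forcing a b c d)
         (λ f → forcer-coloured f , target-uncoloured f , adjacent f , others-coloured f)
         ((v ∈ᶜ? C) ×-dec ¬? (w ∈ᶜ? C) ×-dec adj? v w ×-dec
          ∀ᵛ? (λ x → adj? v x →-dec (¬? (x ≟ᵛ w) →-dec (x ∈ᶜ? C))))

  some-force? : ∀ C → Dec (∃₂ (Forces C))
  some-force? C = ∃ᵛ? λ v → ∃ᵛ? λ w → forces? C v w

  data Reachable : Colouring → Set where
    start : Reachable initial
    force : ∀ {C v w} → Reachable C → Forces C v w → Reachable (C ⊕ w)

  initial-⊆ : ∀ {C} → Reachable C → initial ⊆ C
  initial-⊆ start       = id
  initial-⊆ (force r _) = ⊕-⊆ ∘ initial-⊆ r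

  stalled-⊇-𝒫 : ∀ {C} → initial ⊆ C → (∀ v w → ¬ Forces C v w) → ∀ {x} → 𝒫 G S x → x ∈ᶜ C
  stalled-⊇-𝒫 init⊆ _ (rule1-self x∈S) = init⊆ (dominated-initial (Any.map (inj₁ ∘ sym) x∈S))
  stalled-⊇-𝒫 init⊆ _ (rule1-nbr u∈S a) = init⊆ (dominated-initial (Any.map (λ { refl → inj₂ a }) u∈S))
  stalled-⊇-𝒫 {C} init⊆ stalled (rule2 {v} {w} pv a others) with w ∈ᶜ? C
  ... | yes w∈C = w∈C
  ... | no  w∉C = ⊥-elim (stalled v w (forcing (stalled-⊇-𝒫 init⊆ stalled pv) w∉C a
                                           λ x ax x≢w → stalled-⊇-𝒫 init⊆ stalled (others x ax x≢w)))

  record Crossing (P : Colouring → Set) : Set where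
    constructor crossing
    field
      {C}       : Colouring
      {v w}     : V G
      reachable : Reachable C
      forces    : Forces C v w
      before    : ¬ P C
      after     : P (C ⊕ w)

  first-crossing : PowerDominates G S → {P : Colouring → Set} → (∀ C → Dec (P C)) →
                   (∀ {C} → (∀ x → x ∈ᶜ C) → P C) → P initial ⊎ Crossing P
  first-crossing pd {P} P? P-full with P? initial
  ... | yes p = inj₁ p
  ... | no ¬p = inj₂ (search n start (m≤m+n n ∣ initial ∣) ¬p)
    where
    -- the fuel k bounds the number of vertices that are still uncoloured
    search : ∀ k {C} → Reachable C → n ≤ k + ∣ C ∣ → ¬ P C → Crossing P
    search k {C} r n≤ ¬pC with some-force? C
    ... | no stalled = contradiction
          (P-full λ x → stalled-⊇-𝒫 (initial-⊆ r) (λ v w f → stalled (v , w , f)) (pd x)) ¬pC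
    ... | yes (v , w , f) with P? (C ⊕ w)
    ...   | yes pC′ = crossing r f ¬pC pC′
    ...   | no ¬pC′ with k | p⊂q⇒∣p∣<∣q∣ (⊕-⊂ {C} {w} (target-uncoloured f))
    ...     | zero  | grows = contradiction (∣p∣≤n (C ⊕ w)) (<⇒≱ (≤-<-trans n≤ grows))
    ...     | suc k | grows = search k (force r f)
                (≤-trans n≤ (≤-trans (≤-reflexive (sym (+-suc k ∣ C ∣))) (+-monoʳ-≤ k grows))) ¬pC′

  Active : Colouring → V G → Set
  Active C x = x ∈ᶜ C × ∃ λ y → Adj G x y × y ∉ᶜ C

  -- When v forces w, the label of v is handed on to w: v itself is no longer active.
  relabel-after-force : ∀ {C v w L} → Forces C v w → Labelling (Active C) L → Labelling (Active (C ⊕ w)) L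
  relabel-after-force {C} {v} {w} {L} f lab = record
    { label           = λ {x} → relabel (x ≟ᵛ w)
    ; label-injective = λ {x} {y} → relabel-injective (x ≟ᵛ w) (y ≟ᵛ w)
    }
    where
    forcer-active : Active C v
    forcer-active = forcer-coloured f , w , adjacent f , target-uncoloured f

    forcer-inactive : ¬ Active (C ⊕ w) v
    forcer-inactive (_ , y , ay , y∉) with y ≟ᵛ w
    ... | yes refl = y∉ ∈⊕-self
    ... | no y≢w   = y∉ (⊕-⊆ (others-coloured f y ay y≢w))

    still-active : ∀ {x} → x ≢ w → Active (C ⊕ w) x → Active C x
    still-active x≢w (x∈ , y , axy , y∉) =
      [ id , ⊥-elim ∘ x≢w ] (∈⊕⁻ x∈) , y , axy , y∉ ∘ ⊕-⊆

    relabel : ∀ {x} → Dec (x ≡ w) → Active (C ⊕ w) x → L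
    relabel (yes _)   _ = label lab forcer-active
    relabel (no x≢w)  a = label lab (still-active x≢w a)

    relabel-injective : ∀ {x y} (dx : Dec (x ≡ w)) (dy : Dec (y ≡ w)) (a : Active (C ⊕ w) x)
                        (b : Active (C ⊕ w) y) → relabel dx a ≡ relabel dy b → x ≡ y
    relabel-injective (yes refl) (yes refl) _ _ _  = refl
    relabel-injective (yes _)    (no y≢w)   _ b eq
      with refl ← label-injective lab forcer-active (still-active y≢w b) eq = ⊥-elim (forcer-inactive b)
    relabel-injective (no x≢w)   (yes _)    a _ eq
      with refl ← label-injective lab (still-active x≢w a) forcer-active eq = ⊥-elim (forcer-inactive a)
    relabel-injective (no x≢w)   (no y≢w)   a b eq =
      label-injective lab (still-active x≢w a) (still-active y≢w b) eq

  module _ {k} (ports : ∀ u → Labelling (ClosedNbhd G u) (Fin k)) where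

    dominated-labelling : Labelling Dominated (Fin (k * length S))
    dominated-labelling = mapLabels (uncurry combine) combine-pair-injective (record
      { label           = λ d → label (ports _) (lookup-index d) , Any.index d
      ; label-injective = λ d e eq →
          same-port (cong proj₂ eq) (lookup-index d) (lookup-index e) (cong proj₁ eq)
      })
      where
      same-port : ∀ {i j x y} → i ≡ j →
                  (p : ClosedNbhd G (List.lookup S i) x) (q : ClosedNbhd G (List.lookup S j) y) →
                  label (ports _) p ≡ label (ports _) q → x ≡ y
      same-port refl = label-injective (ports _)

    active-labelling : ∀ {C} → Reachable C → Labelling (Active C) (Fin (k * length S))
    active-labelling start       = restrict (initial-dominated ∘ proj₁) dominated-labelling
    active-labelling (force r f) = relabel-after-force f (active-labelling r)

succ±? : ∀ {n} (a b : Fin n) → Dec (Succ± a b)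
succ±? a b = (suc (toℕ a) ℕ.≟ toℕ b) ⊎-dec (suc (toℕ b) ℕ.≟ toℕ a)

side : ∀ {n} {a b : Fin n} → Succ± a b → Fin 2
side (inj₁ _) = zero
side (inj₂ _) = suc zero

side-injective : ∀ {n} {a b c : Fin n} (p : Succ± a b) (q : Succ± a c) → side p ≡ side q → b ≡ c
side-injective (inj₁ p) (inj₁ q) _ = toℕ-injective (trans (sym p) q)
side-injective (inj₂ p) (inj₂ q) _ = toℕ-injective (ℕ.suc-injective (trans p (sym q)))
side-injective (inj₁ _) (inj₂ _) ()
side-injective (inj₂ _) (inj₁ _) ()

Edge : ∀ {n} → (Fin n → Set) → Set
Edge P = ∃₂ λ k k′ → Succ± k k′ × P k × ¬ P k′

edge-suc : ∀ {n} {P : Fin (suc n) → Set} → Edge (P ∘ suc) → Edge P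
edge-suc (k , k′ , s , pk , ¬pk′) = suc k , suc k′ , Sum.map (cong suc) (cong suc) s , pk , ¬pk′

edge-from-zero : ∀ {n} {P : Fin (suc n) → Set} → (∀ i → Dec (P i)) → ∀ {b} → P zero → ¬ P b → Edge P
edge-from-zero P? {zero} p0 ¬pb = contradiction p0 ¬pb
edge-from-zero {suc _} P? {suc b} p0 ¬pb with P? (suc zero)
... | no ¬p1 = zero , suc zero , inj₁ refl , p0 , ¬p1
... | yes p1 = edge-suc (edge-from-zero (P? ∘ suc) p1 ¬pb)

edge-to-zero : ∀ {n} {P : Fin (suc n) → Set} → (∀ i → Dec (P i)) → ∀ {a} → ¬ P zero → P a → Edge P
edge-to-zero P? {zero} ¬p0 pa = contradiction pa ¬p0
edge-to-zero {suc _} P? {suc a} ¬p0 pa with P? (suc zero)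
... | yes p1 = suc zero , zero , inj₂ refl , p1 , ¬p0
... | no ¬p1 = edge-suc (edge-to-zero (P? ∘ suc) ¬p1 pa)

edge-between : ∀ {n} {P : Fin n → Set} → (∀ i → Dec (P i)) → ∀ {a b} → P a → ¬ P b → Edge P
edge-between {suc _} P? pa ¬pb with P? zero
... | yes p0 = edge-from-zero P? p0 ¬pb
... | no ¬p0 = edge-to-zero P? ¬p0 pa

module _ {ℓ m : ℕ} where

  grid-adj? : Decidable (Adj (Grid ℓ m))
  grid-adj? (i , j) (i′ , j′) = ((i Fin.≟ i′) ×-dec succ±? j j′) ⊎-dec ((j Fin.≟ j′) ×-dec succ±? i i′)

  direction : ∀ {u x} → Adj (Grid ℓ m) u x → Fin 2 × Fin 2
  direction (inj₁ (_ , s)) = zero , side s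
  direction (inj₂ (_ , s)) = suc zero , side s

  direction-injective : ∀ {u x y} (a : Adj (Grid ℓ m) u x) (b : Adj (Grid ℓ m) u y) →
                        direction a ≡ direction b → x ≡ y
  direction-injective (inj₁ (refl , s)) (inj₁ (refl , s′)) eq = cong (_ ,_) (side-injective s s′ (cong proj₂ eq))
  direction-injective (inj₂ (refl , s)) (inj₂ (refl , s′)) eq = cong (_, _) (side-injective s s′ (cong proj₂ eq))
  direction-injective (inj₁ _) (inj₂ _) ()
  direction-injective (inj₂ _) (inj₁ _) ()

  grid-ports : ∀ u → Labelling (ClosedNbhd (Grid ℓ m) u) (Fin 5)
  grid-ports = closedNbhd-labelling λ u →
    mapLabels (uncurry combine) combine-pair-injective
      (record { label = direction ; label-injective = direction-injective })

module GridLowerBound (ℓ′ m′ : ℕ) (S : List (Fin (suc ℓ′) × Fin (suc m′))) where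

  open Forcing (Grid (suc ℓ′) (suc m′)) (↔-sym *↔×) grid-adj? S

  FullRow FullColumn FullLine : Colouring → Set
  FullRow    C = ∃ λ i → ∀ j → (i , j) ∈ᶜ C
  FullColumn C = ∃ λ j → ∀ i → (i , j) ∈ᶜ C
  FullLine   C = FullRow C ⊎ FullColumn C

  fullLine? : ∀ C → Dec (FullLine C)
  fullLine? C = any? (λ i → all? λ j → (i , j) ∈ᶜ? C) ⊎-dec any? (λ j → all? λ i → (i , j) ∈ᶜ? C)

  column-has-active : ∀ {C} i i₀ c → (i , c) ∈ᶜ C → (i₀ , c) ∉ᶜ C → ∃ λ k → Active C (k , c)
  column-has-active {C} i i₀ c i∈ i₀∉ with edge-between (λ k → (k , c) ∈ᶜ? C) {i} {i₀} i∈ i₀∉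
  ... | k , k′ , s , k∈ , k′∉ = k , k∈ , (k′ , c) , inj₂ (refl , s) , k′∉

  row-has-active : ∀ {C} r j j₀ → (r , j) ∈ᶜ C → (r , j₀) ∉ᶜ C → ∃ λ k → Active C (r , k)
  row-has-active {C} r j j₀ j∈ j₀∉ with edge-between (λ k → (r , k) ∈ᶜ? C) {j} {j₀} j∈ j₀∉
  ... | k , k′ , s , k∈ , k′∉ = k , k∈ , (r , k′) , inj₁ (refl , s) , k′∉

  initial-row-bound : FullRow initial → suc m′ ≤ 5 * length S
  initial-row-bound (i , row) =
    labelled-family-≤ (dominated-labelling grid-ports) (i ,_) (initial-dominated ∘ row) (cong proj₂)

  initial-column-bound : FullColumn initial → suc ℓ′ ≤ 5 * length S
  initial-column-bound (j , col) =
    labelled-family-≤ (dominated-labelling grid-ports) (_, j) (initial-dominated ∘ col) (cong proj₁)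

  -- Every column other than that of w was not full before w was coloured.
  crossing-row-bound : (x : Crossing FullLine) → let open Crossing x in
                       FullRow (C ⊕ w) → m′ ≤ 5 * length S
  crossing-row-bound (crossing {C} {_} {w} r f ¬full _) (i , row) =
    labelled-family-≤ (active-labelling grid-ports (force r f)) (λ t → proj₁ (witness t) , column t)
                      (proj₂ ∘ witness) (punchIn-injective (proj₂ w) _ _ ∘ cong proj₂)
    where
    column : Fin m′ → Fin (suc m′)
    column = punchIn (proj₂ w)

    witness : ∀ t → ∃ λ k → Active (C ⊕ w) (k , column t)
    witness t with ¬∀⟶∃¬ _ _ (λ k → (k , column t) ∈ᶜ? C) (λ full → ¬full (inj₂ (column t , full)))
    ... | i₀ , i₀∉ = column-has-active i i₀ (column t) (row (column t))
                       (∉⊕ {w = w} {x = i₀ , column t} i₀∉ (punchInᵢ≢i (proj₂ w) t ∘ cong proj₂))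

  crossing-column-bound : (x : Crossing FullLine) → let open Crossing x in
                          FullColumn (C ⊕ w) → ℓ′ ≤ 5 * length S
  crossing-column-bound (crossing {C} {_} {w} r f ¬full _) (j , col) =
    labelled-family-≤ (active-labelling grid-ports (force r f)) (λ t → line t , proj₁ (witness t))
                      (proj₂ ∘ witness) (punchIn-injective (proj₁ w) _ _ ∘ cong proj₁)
    where
    line : Fin ℓ′ → Fin (suc ℓ′)
    line = punchIn (proj₁ w)

    witness : ∀ t → ∃ λ k → Active (C ⊕ w) (line t , k)
    witness t with ¬∀⟶∃¬ _ _ (λ k → (line t , k) ∈ᶜ? C) (λ full → ¬full (inj₁ (line t , full)))
    ... | j₀ , j₀∉ = row-has-active (line t) j j₀ (col (line t))
                       (∉⊕ {w = w} {x = line t , j₀} j₀∉ (punchInᵢ≢i (proj₁ w) t ∘ cong proj₁))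

  pred-ℓ-bound : ℓ′ ≤ m′ → PowerDominates (Grid (suc ℓ′) (suc m′)) S → ℓ′ ≤ 5 * length S
  pred-ℓ-bound ℓ′≤m′ pd with first-crossing pd fullLine? (λ all → inj₁ (zero , λ j → all (zero , j)))
  ... | inj₁ (inj₁ row) = ≤-trans (≤-trans ℓ′≤m′ (n≤1+n m′)) (initial-row-bound row)
  ... | inj₁ (inj₂ col) = ≤-trans (n≤1+n ℓ′) (initial-column-bound col)
  ... | inj₂ x with Crossing.after x
  ...   | inj₁ row = ≤-trans ℓ′≤m′ (crossing-row-bound x row)
  ...   | inj₂ col = crossing-column-bound x col

lower-bound : ∀ ℓ m → ℓ ≤ m → ScaledOptAtLeast (Grid ℓ m) 6 ℓ
lower-bound zero     _        _         _ _ _  = z≤n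
lower-bound (suc ℓ′) (suc m′) (s≤s ℓ′≤m′) S _ pd =
  +-mono-≤ (𝒫-nonempty (pd (zero , zero))) (GridLowerBound.pred-ℓ-bound ℓ′ m′ S ℓ′≤m′ pd)

module _ {ℓ m : ℕ} where

  firstColumn : List (Fin ℓ × Fin (suc m))
  firstColumn = map (_, zero) (allFin ℓ)

  -- Every neighbour of (i , inject₁ j) other than (i , suc j) lies in a column ≤ toℕ j.
  columns-≤-dominated : ∀ c i (j : Fin (suc m)) → toℕ j ≤ c → 𝒫 (Grid ℓ (suc m)) firstColumn (i , j)
  columns-≤-dominated c       i zero    _         = rule1-self (∈-map⁺ _ (∈-allFin i))
  columns-≤-dominated (suc c) i (suc j) (s≤s j≤c) =
    rule2 (columns-≤-dominated c i (inject₁ j) p≤c) (inj₁ (refl , inj₁ (cong suc (toℕ-inject₁ j)))) others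
    where
    p≤c : toℕ (inject₁ j) ≤ c
    p≤c = subst (_≤ c) (sym (toℕ-inject₁ j)) j≤c

    others : ∀ x → Adj (Grid ℓ (suc m)) (i , inject₁ j) x → x ≢ (i , suc j) →
             𝒫 (Grid ℓ (suc m)) firstColumn x
    others (_ , j′) (inj₁ (refl , inj₁ e)) x≢ =
      contradiction (cong (i ,_) (toℕ-injective (trans (sym e) (cong suc (toℕ-inject₁ j))))) x≢
    others (_ , j′) (inj₁ (refl , inj₂ e)) _  =
      columns-≤-dominated c i j′ (≤-trans (n≤1+n _) (subst (_≤ c) (sym e) p≤c))
    others (i′ , _) (inj₂ (refl , _))      _  = columns-≤-dominated c i′ (inject₁ j) p≤c

upper-bound : ∀ ℓ m → ℓ ≤ m → OptAtMost (Grid ℓ m) (1 * ℓ)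
upper-bound zero zero    _ = [] , AllPairs.[] , (λ { (() , _) }) , z≤n
upper-bound ℓ    (suc m) _ =
  firstColumn , Unique.map⁺ (cong proj₁) (allFin⁺ ℓ) ,
  (λ (i , j) → columns-≤-dominated (toℕ j) i j ≤-refl) ,
  ≤-reflexive (trans (trans (length-map _ (allFin ℓ)) (length-tabulate _)) (sym (*-identityˡ ℓ)))

proposition1 : Σ ℕ λ a → Σ ℕ λ b → NonZero a × NonZero b ×
    (∀ (ℓ m : ℕ) → ℓ ≤ m → ScaledOptAtLeast (Grid ℓ m) a ℓ × OptAtMost (Grid ℓ m) (b * ℓ))
proposition1 = 6 , 1 , _ , _ , λ ℓ m ℓ≤m → lower-bound ℓ m ℓ≤m , upper-bound ℓ m ℓ≤m
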